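{- Let $H=(V,\mathcal{E})$ be a hypergraph and let $X,Y\subseteq V$ with $X\cap Y=\emptyset$ be such that $\mathcal{E}$ separates $X$ and $Y$. Let $t_X$ (respectively $t_Y$) be the number of classes induced by $\mathcal{E}$ that intersect $X$ (respectively $Y$). Then there is a subset $\mathcal{F}\subseteq\mathcal{E}$ with at most $t_X+t_Y-1$ edges that separates $X$ and $Y$.
   Context: A hypergraph $H=(V,\mathcal{E})$ has a finite vertex set $V$ and a collection $\mathcal{E}$ of subsets of $V$ (edges). An edge $e$ separates vertices $x,y$ if $|\{x,y\}\cap e|=1$. A collection of edges separates disjoint sets $X,Y\subseteq V$ if every pair $(x,y)$ with $x\in X$, $y\in Y$ is separated by some edge of the collection. For $\mathcal{T}\subseteq\mathcal{E}$, the classes induced by $\mathcal{T}$ are the maximal subsets $C\subseteq V$ such that no pair of vertices of $C$ is separated by an edge of $\mathcal{T}$; they partition $V$. -}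

module Defs where

open import Data.Nat using (ℕ)
open import Data.Bool using (Bool; true; false; _∧_)
import Data.Bool as B
open import Data.Fin using (Fin)
open import Data.Fin.Subset using (Subset; _∈_; _∉_)
open import Data.Fin.Subset.Properties using (_∈?_)
open import Data.Vec using (lookup; tabulate)
import Data.Vec.Properties as VP
open import Data.List using (List; map; filter; length; allFin)
open import Data.Bool.ListAction using (and)
open import Data.List using (deduplicate)
open import Data.Sum using (_⊎_)
open import Data.Product using (_×_; ∃-syntax)
open import Relation.Nullary using (does)
open import Relation.Binary.PropositionalEquality using (_≡_)

Hypergraph : ℕ → ℕ → Set
Hypergraph n m = Fin m → Subset n

SeparatesPair : ∀ {n} → Subset n → Fin n → Fin n → Set
SeparatesPair e x y = (x ∈ e × y ∉ e) ⊎ (x ∉ e × y ∈ e)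

Separates : ∀ {n m} → Hypergraph n m → Subset m → Subset n → Subset n → Set
Separates E F X Y =
  ∀ x y → x ∈ X → y ∈ Y → ∃[ i ] (i ∈ F × SeparatesPair (E i) x y)

allEdges : ∀ {m} → Subset m
allEdges = tabulate (λ _ → true)

notSeparatedB : ∀ {n m} → Hypergraph n m → Fin n → Fin n → Bool
notSeparatedB {m = m} E x w =
  and (map (λ i → does (lookup (E i) x B.≟ lookup (E i) w)) (allFin m))

classOf : ∀ {n m} → Hypergraph n m → Fin n → Subset n
classOf E x = tabulate (notSeparatedB E x)

numClassesMeeting : ∀ {n m} → Hypergraph n m → Subset n → ℕ
numClassesMeeting {n} E X =
  length (deduplicate (VP.≡-dec B._≟_)
           (map (classOf E) (filter (λ v → v ∈? X) (allFin n))))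

-- Choose one vertex from each class meeting X and each class meeting Y; an edge separates
-- two vertices iff it separates their classes, so it suffices to separate these
-- t_X + t_Y representatives. Going through the edges one at a time, an edge e splits the
-- representatives into those inside e and those outside, each of which is separated
-- recursively by the remaining edges. The edge e itself is kept only if both sides are
-- non-empty, and then 1 + (s₁ - 1) + (s₀ - 1) = s₁ + s₀ - 1, so by induction at most
-- (number of representatives) - 1 edges are kept.
module Submission where

open import Defs
open import Algebra.Properties.CommutativeSemigroup using (interchange)
open import Data.Bool using (Bool; true; false; T)
import Data.Bool as Bool
open import Data.Bool.Properties using (T-≡)
open import Data.Empty using (⊥-elim)
open import Data.Fin using (Fin)
open import Data.Fin.Subset using (Subset; _∈_; _∉_; _⊆_; ∣_∣; _∪_; ⁅_⁆; ⊥)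
open import Data.Fin.Subset.Properties
  using (_∈?_; ∣⊥∣≡0; ∣⁅x⁆∣≡1; x∈⁅x⁆; p⊆p∪q; q⊆p∪q)
open import Data.List using (List; []; _∷_; map; filter; length; allFin; deduplicate)
open import Data.List.Membership.Propositional using (find; lose) renaming (_∈_ to _∈ₗ_)
open import Data.List.Membership.Propositional.Properties
  using (∈-filter⁺; ∈-filter⁻; ∈-allFin; ∈-deduplicate⁻)
open import Data.List.Properties using (length-map)
import Data.List.Relation.Unary.All as All
open import Data.List.Relation.Unary.All.Properties using (all⁺; all⁻)
open import Data.List.Relation.Unary.Any using (Any; here; there)
import Data.List.Relation.Unary.Any as Any
open import Data.List.Relation.Unary.Any.Properties using (deduplicate⁺; ¬Any[])
open import Data.Nat using (ℕ; zero; suc; _+_; _∸_; _≤_; _<_; z≤n; s≤s)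
open import Data.Nat.Properties
  using (≤-refl; ≤-reflexive; ≤-trans; <-≤-trans; +-mono-≤; +-monoʳ-≤; +-suc; n≤1+n;
         m≤m+n; m≤n+m; +-commutativeSemigroup; module ≤-Reasoning)
open import Data.Product using (Σ-syntax; ∃-syntax; _×_; _,_; proj₁; proj₂; map₁; map₂)
open import Data.Sum using (inj₁; inj₂)
open import Data.Vec using (lookup; []; _∷_)
open import Data.Vec.Properties using (lookup∘tabulate; lookup⇒[]=; []=⇒lookup; ≡-dec)
open import Function using (_∘_; Equivalence)
open import Relation.Binary.Definitions using (DecidableEquality)
open import Relation.Binary.PropositionalEquality
open import Relation.Nullary using (Dec; yes; no; ¬_; ¬?; does)
open import Relation.Nullary.Decidable using (dec-true)
open import Relation.Unary using (Decidable)

∣p∪q∣≤∣p∣+∣q∣ : ∀ {n} (p q : Subset n) → ∣ p ∪ q ∣ ≤ ∣ p ∣ + ∣ q ∣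
∣p∪q∣≤∣p∣+∣q∣ []           []           = z≤n
∣p∪q∣≤∣p∣+∣q∣ (true ∷ p)  (true ∷ q)  = s≤s (≤-trans (∣p∪q∣≤∣p∣+∣q∣ p q) (+-monoʳ-≤ ∣ p ∣ (n≤1+n ∣ q ∣)))
∣p∪q∣≤∣p∣+∣q∣ (true ∷ p)  (false ∷ q) = s≤s (∣p∪q∣≤∣p∣+∣q∣ p q)
∣p∪q∣≤∣p∣+∣q∣ (false ∷ p) (true ∷ q)  = ≤-trans (s≤s (∣p∪q∣≤∣p∣+∣q∣ p q)) (≤-reflexive (sym (+-suc ∣ p ∣ ∣ q ∣)))
∣p∪q∣≤∣p∣+∣q∣ (false ∷ p) (false ∷ q) = ∣p∪q∣≤∣p∣+∣q∣ p q

∈-resp-lookup : ∀ {n} (s : Subset n) {x y} → lookup s x ≡ lookup s y → y ∈ s → x ∈ s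
∈-resp-lookup s {x} eq y∈s = lookup⇒[]= x s (trans eq ([]=⇒lookup y∈s))

p⊆allEdges : ∀ {m} (F : Subset m) → F ⊆ allEdges
p⊆allEdges F {i} _ = lookup⇒[]= i allEdges (lookup∘tabulate _ i)

∈⇒0<length : ∀ {A : Set} {x : A} {xs} → x ∈ₗ xs → 0 < length xs
∈⇒0<length (here _)  = s≤s z≤n
∈⇒0<length (there _) = s≤s z≤n

∈⇒0<length+lengthˡ : ∀ {A : Set} {x : A} {xs} (ys : List A) → x ∈ₗ xs → 0 < length xs + length ys
∈⇒0<length+lengthˡ {xs = xs} ys x∈xs = <-≤-trans (∈⇒0<length x∈xs) (m≤m+n (length xs) (length ys))

∈⇒0<length+lengthʳ : ∀ {A : Set} {x : A} (xs : List A) {ys} → x ∈ₗ ys → 0 < length xs + length ys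
∈⇒0<length+lengthʳ xs {ys} x∈ys = <-≤-trans (∈⇒0<length x∈ys) (m≤n+m (length ys) (length xs))

length-filter+length-filter-¬ : ∀ {A : Set} {P : A → Set} (P? : Decidable P) xs →
  length (filter P? xs) + length (filter (¬? ∘ P?) xs) ≡ length xs
length-filter+length-filter-¬ P? [] = refl
length-filter+length-filter-¬ P? (x ∷ xs) with P? x
... | yes _ = cong suc (length-filter+length-filter-¬ P? xs)
... | no _  = trans (+-suc _ _) (cong suc (length-filter+length-filter-¬ P? xs))

T-does-≟ : ∀ {a b : Bool} → T (does (a Bool.≟ b)) → a ≡ b
T-does-≟ {false} {false} _ = refl
T-does-≟ {true}  {true}  _ = refl

module Representatives {A B : Set} (f : A → B) (_≟_ : DecidableEquality B) where

  _≟ᶠ_ : (x y : A) → Dec (f x ≡ f y)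
  x ≟ᶠ y = f x ≟ f y

  map-filter : ∀ {P : B → Set} (P? : Decidable P) xs →
    map f (filter (P? ∘ f) xs) ≡ filter P? (map f xs)
  map-filter P? [] = refl
  map-filter P? (x ∷ xs) with P? (f x)
  ... | yes _ = cong (f x ∷_) (map-filter P? xs)
  ... | no _  = map-filter P? xs

  map-deduplicate : ∀ xs → map f (deduplicate _≟ᶠ_ xs) ≡ deduplicate _≟_ (map f xs)
  map-deduplicate [] = refl
  map-deduplicate (x ∷ xs) = cong (f x ∷_) (begin
    map f (filter (¬? ∘ (x ≟ᶠ_)) (deduplicate _≟ᶠ_ xs)) ≡⟨ map-filter (¬? ∘ (f x ≟_)) (deduplicate _≟ᶠ_ xs) ⟩
    filter (¬? ∘ (f x ≟_)) (map f (deduplicate _≟ᶠ_ xs)) ≡⟨ cong (filter _) (map-deduplicate xs) ⟩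
    filter (¬? ∘ (f x ≟_)) (deduplicate _≟_ (map f xs)) ∎)
    where open ≡-Reasoning

  length-deduplicate-map : ∀ xs → length (deduplicate _≟ᶠ_ xs) ≡ length (deduplicate _≟_ (map f xs))
  length-deduplicate-map xs =
    trans (sym (length-map f (deduplicate _≟ᶠ_ xs))) (cong length (map-deduplicate xs))

  representative : ∀ {x xs} → x ∈ₗ xs → ∃[ p ] (p ∈ₗ deduplicate _≟ᶠ_ xs × f x ≡ f p)
  representative x∈xs =
    find (deduplicate⁺ _≟ᶠ_ (λ fy≡fz fx≡fz → trans fx≡fz (sym fy≡fz))
                              (Any.map (cong f) x∈xs))

module Separation {n m : ℕ} (E : Hypergraph n m) where

  SeparatesLists : Subset m → List (Fin n) → List (Fin n) → Set
  SeparatesLists F P Q =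
    ∀ {p q} → p ∈ₗ P → q ∈ₗ Q → ∃[ i ] (i ∈ F × SeparatesPair (E i) p q)

  SeparatedBy : List (Fin m) → List (Fin n) → List (Fin n) → Set
  SeparatedBy A P Q = ∀ {p q} → p ∈ₗ P → q ∈ₗ Q → Any (λ i → SeparatesPair (E i) p q) A

  ¬SeparatesPair-∈ : ∀ {s : Subset n} {p q} → p ∈ s → q ∈ s → ¬ SeparatesPair s p q
  ¬SeparatesPair-∈ _   q∈s (inj₁ (_ , q∉s)) = q∉s q∈s
  ¬SeparatesPair-∈ p∈s _   (inj₂ (p∉s , _)) = p∉s p∈s

  ¬SeparatesPair-∉ : ∀ {s : Subset n} {p q} → p ∉ s → q ∉ s → ¬ SeparatesPair s p q
  ¬SeparatesPair-∉ p∉s _   (inj₁ (p∈s , _)) = p∉s p∈s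
  ¬SeparatesPair-∉ _   q∉s (inj₂ (_ , q∈s)) = q∉s q∈s

  SeparatesLists-mono : ∀ {F G P Q} → F ⊆ G → SeparatesLists F P Q → SeparatesLists G P Q
  SeparatesLists-mono F⊆G sep p∈ q∈ = map₂ (map₁ F⊆G) (sep p∈ q∈)

  -- The arguments are the numbers of representatives inside and outside the edge e.
  bridge : ℕ → ℕ → Fin m → Subset m
  bridge (suc _) (suc _) e = ⁅ e ⁆
  bridge _       _       _ = ⊥

  ∈-bridge : ∀ {a b} e → 0 < a → 0 < b → e ∈ bridge a b e
  ∈-bridge e (s≤s _) (s≤s _) = x∈⁅x⁆ e

  ∣bridge∣+split≤ : ∀ a b e → ∣ bridge a b e ∣ + ((a ∸ 1) + (b ∸ 1)) ≤ a + b ∸ 1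
  ∣bridge∣+split≤ (suc a) (suc b) e rewrite ∣⁅x⁆∣≡1 e = ≤-reflexive (sym (+-suc a b))
  ∣bridge∣+split≤ zero    b       e rewrite ∣⊥∣≡0 m = ≤-refl
  ∣bridge∣+split≤ (suc a) zero    e rewrite ∣⊥∣≡0 m = ≤-refl

  inside outside : Fin m → List (Fin n) → List (Fin n)
  inside  e = filter (_∈? E e)
  outside e = filter (¬? ∘ (_∈? E e))

  ∈-inside⁺ : ∀ {e P p} → p ∈ₗ P → p ∈ E e → p ∈ₗ inside e P
  ∈-inside⁺ {e} = ∈-filter⁺ (_∈? E e)

  ∈-outside⁺ : ∀ {e P p} → p ∈ₗ P → p ∉ E e → p ∈ₗ outside e P
  ∈-outside⁺ {e} = ∈-filter⁺ (¬? ∘ (_∈? E e))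

  SeparatedBy-inside : ∀ {e A P Q} → SeparatedBy (e ∷ A) P Q → SeparatedBy A (inside e P) (inside e Q)
  SeparatedBy-inside {e} {P = P} {Q} sep p∈ q∈
    with ∈-filter⁻ (_∈? E e) {xs = P} p∈ | ∈-filter⁻ (_∈? E e) {xs = Q} q∈
  ... | p∈P , p∈e | q∈Q , q∈e = Any.tail (¬SeparatesPair-∈ p∈e q∈e) (sep p∈P q∈Q)

  SeparatedBy-outside : ∀ {e A P Q} → SeparatedBy (e ∷ A) P Q → SeparatedBy A (outside e P) (outside e Q)
  SeparatedBy-outside {e} {P = P} {Q} sep p∈ q∈
    with ∈-filter⁻ (¬? ∘ (_∈? E e)) {xs = P} p∈ | ∈-filter⁻ (¬? ∘ (_∈? E e)) {xs = Q} q∈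
  ... | p∈P , p∉e | q∈Q , q∉e = Any.tail (¬SeparatesPair-∉ p∉e q∉e) (sep p∈P q∈Q)

  separatingSubset : ∀ A P Q → SeparatedBy A P Q →
    Σ[ F ∈ Subset m ] (∣ F ∣ ≤ length P + length Q ∸ 1 × SeparatesLists F P Q)
  separatingSubset []      P Q sep = ⊥ , ≤-trans (≤-reflexive (∣⊥∣≡0 m)) z≤n ,
    λ p∈ q∈ → ⊥-elim (¬Any[] (sep p∈ q∈))
  separatingSubset (e ∷ A) P Q sep = F , card , separates
    where
      P₁ = inside e P
      Q₁ = inside e Q
      P₀ = outside e P
      Q₀ = outside e Q
      s₁ = length P₁ + length Q₁
      s₀ = length P₀ + length Q₀

      F₁ = separatingSubset A P₁ Q₁ (SeparatedBy-inside sep)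
      F₀ = separatingSubset A P₀ Q₀ (SeparatedBy-outside sep)
      F₁₀ = proj₁ F₁ ∪ proj₁ F₀
      F = bridge s₁ s₀ e ∪ F₁₀

      s₁+s₀≡ : s₁ + s₀ ≡ length P + length Q
      s₁+s₀≡ = trans (interchange +-commutativeSemigroup (length P₁) (length Q₁) (length P₀) (length Q₀))
                     (cong₂ _+_ (length-filter+length-filter-¬ (_∈? E e) P)
                                (length-filter+length-filter-¬ (_∈? E e) Q))

      card : ∣ F ∣ ≤ length P + length Q ∸ 1
      card = begin
        ∣ F ∣                                      ≤⟨ ∣p∪q∣≤∣p∣+∣q∣ (bridge s₁ s₀ e) F₁₀ ⟩
        ∣ bridge s₁ s₀ e ∣ + ∣ F₁₀ ∣               ≤⟨ +-monoʳ-≤ ∣ bridge s₁ s₀ e ∣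
                                                      (≤-trans (∣p∪q∣≤∣p∣+∣q∣ (proj₁ F₁) (proj₁ F₀))
                                                        (+-mono-≤ (proj₁ (proj₂ F₁)) (proj₁ (proj₂ F₀)))) ⟩
        ∣ bridge s₁ s₀ e ∣ + ((s₁ ∸ 1) + (s₀ ∸ 1)) ≤⟨ ∣bridge∣+split≤ s₁ s₀ e ⟩
        s₁ + s₀ ∸ 1                                ≡⟨ cong (_∸ 1) s₁+s₀≡ ⟩
        length P + length Q ∸ 1                    ∎
        where open ≤-Reasoning

      bridge⊆F : bridge s₁ s₀ e ⊆ F
      bridge⊆F = p⊆p∪q F₁₀
      F₁⊆F : proj₁ F₁ ⊆ F
      F₁⊆F = q⊆p∪q (bridge s₁ s₀ e) F₁₀ ∘ p⊆p∪q (proj₁ F₀)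
      F₀⊆F : proj₁ F₀ ⊆ F
      F₀⊆F = q⊆p∪q (bridge s₁ s₀ e) F₁₀ ∘ q⊆p∪q (proj₁ F₁) (proj₁ F₀)

      separates : SeparatesLists F P Q
      separates {p} {q} p∈P q∈Q with p ∈? E e | q ∈? E e
      ... | yes p∈e | yes q∈e =
        SeparatesLists-mono F₁⊆F (proj₂ (proj₂ F₁)) (∈-inside⁺ p∈P p∈e) (∈-inside⁺ q∈Q q∈e)
      ... | no p∉e  | no q∉e  =
        SeparatesLists-mono F₀⊆F (proj₂ (proj₂ F₀)) (∈-outside⁺ p∈P p∉e) (∈-outside⁺ q∈Q q∉e)
      ... | yes p∈e | no q∉e  = e , bridge⊆F (∈-bridge e
          (∈⇒0<length+lengthˡ Q₁ (∈-inside⁺ p∈P p∈e)) (∈⇒0<length+lengthʳ P₀ (∈-outside⁺ q∈Q q∉e)))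
          , inj₁ (p∈e , q∉e)
      ... | no p∉e  | yes q∈e = e , bridge⊆F (∈-bridge e
          (∈⇒0<length+lengthʳ P₁ (∈-inside⁺ q∈Q q∈e)) (∈⇒0<length+lengthˡ Q₀ (∈-outside⁺ p∈P p∉e)))
          , inj₂ (p∉e , q∈e)

elements : ∀ {n} → Subset n → List (Fin n)
elements {n} X = filter (_∈? X) (allFin n)

∈-elements⁺ : ∀ {n} {X : Subset n} {x} → x ∈ X → x ∈ₗ elements X
∈-elements⁺ {x = x} x∈X = ∈-filter⁺ (_∈? _) (∈-allFin x) x∈X

∈-elements⁻ : ∀ {n} {X : Subset n} {x} → x ∈ₗ elements X → x ∈ X
∈-elements⁻ {n} {X} x∈ = proj₂ (∈-filter⁻ (_∈? X) {xs = allFin n} x∈)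

module Classes {n m : ℕ} (E : Hypergraph n m) where

  notSeparatedB⇒lookup≡ : ∀ {x w} → T (notSeparatedB E x w) → ∀ i → lookup (E i) x ≡ lookup (E i) w
  notSeparatedB⇒lookup≡ unsep i = T-does-≟ (All.lookup (all⁺ _ (allFin m) unsep) (∈-allFin i))

  notSeparatedB-refl : ∀ x → T (notSeparatedB E x x)
  notSeparatedB-refl x = all⁻ _ (All.universal
    (λ i → Equivalence.from T-≡ (dec-true (lookup (E i) x Bool.≟ lookup (E i) x) refl)) (allFin m))

  classOf-≡⇒lookup≡ : ∀ {x y} → classOf E x ≡ classOf E y → ∀ i → lookup (E i) x ≡ lookup (E i) y
  classOf-≡⇒lookup≡ {x} {y} cx≡cy i = sym (notSeparatedB⇒lookup≡ (subst T unsep (notSeparatedB-refl x)) i)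
    where
      open ≡-Reasoning
      unsep : notSeparatedB E x x ≡ notSeparatedB E y x
      unsep = begin
        notSeparatedB E x x    ≡⟨ sym (lookup∘tabulate _ x) ⟩
        lookup (classOf E x) x ≡⟨ cong (λ c → lookup c x) cx≡cy ⟩
        lookup (classOf E y) x ≡⟨ lookup∘tabulate _ x ⟩
        notSeparatedB E y x    ∎

  SeparatesPair-resp-classOf : ∀ {x y p q} i → classOf E x ≡ classOf E p → classOf E y ≡ classOf E q →
    SeparatesPair (E i) p q → SeparatesPair (E i) x y
  SeparatesPair-resp-classOf i cx≡cp cy≡cq (inj₁ (p∈ , q∉)) =
    inj₁ (∈-resp-lookup (E i) (classOf-≡⇒lookup≡ cx≡cp i) p∈ ,
          q∉ ∘ ∈-resp-lookup (E i) (sym (classOf-≡⇒lookup≡ cy≡cq i)))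
  SeparatesPair-resp-classOf i cx≡cp cy≡cq (inj₂ (p∉ , q∈)) =
    inj₂ (p∉ ∘ ∈-resp-lookup (E i) (sym (classOf-≡⇒lookup≡ cx≡cp i)) ,
          ∈-resp-lookup (E i) (classOf-≡⇒lookup≡ cy≡cq i) q∈)

corollary3 : ∀ {n m} (E : Hypergraph n m) (X Y : Subset n)
             → (∀ v → v ∈ X → v ∉ Y)
             → Separates E allEdges X Y
             → Σ[ F ∈ Subset m ] (F ⊆ allEdges
                 × ∣ F ∣ ≤ numClassesMeeting E X + numClassesMeeting E Y ∸ 1
                 × Separates E F X Y)
corollary3 {n} {m} E X Y _ separatesXY = F , p⊆allEdges F , bound , separates
  where
    open Representatives (classOf E) (≡-dec Bool._≟_)
    open Separation E
    open Classes E

    reps : Subset n → List (Fin n)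
    reps Z = deduplicate _≟ᶠ_ (elements Z)

    ∈-reps⁻ : ∀ {Z p} → p ∈ₗ reps Z → p ∈ Z
    ∈-reps⁻ {Z} p∈ = ∈-elements⁻ (∈-deduplicate⁻ _≟ᶠ_ (elements Z) p∈)

    result = separatingSubset (allFin m) (reps X) (reps Y) λ p∈ q∈ →
      let i , _ , sep = separatesXY _ _ (∈-reps⁻ p∈) (∈-reps⁻ q∈) in lose (∈-allFin i) sep
    F = proj₁ result

    bound : ∣ F ∣ ≤ numClassesMeeting E X + numClassesMeeting E Y ∸ 1
    bound = ≤-trans (proj₁ (proj₂ result)) (≤-reflexive (cong₂ (λ a b → a + b ∸ 1)
      (length-deduplicate-map (elements X)) (length-deduplicate-map (elements Y))))

    separates : Separates E F X Y
    separates x y x∈X y∈Y with representative (∈-elements⁺ x∈X) | representative (∈-elements⁺ y∈Y)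
    ... | p , p∈ , cx≡cp | q , q∈ , cy≡cq =
      map₂ (λ {i} → map₂ (SeparatesPair-resp-classOf i cx≡cp cy≡cq)) (proj₂ (proj₂ result) p∈ q∈)
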